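{- For every positive integer $n$, the equation $a^2+ab+b^2=7^{2n}$ has at least $n$ distinct solutions $(a,b)$ in positive integers $a,b$. -}

module Defs where

open import Data.Nat using (ℕ; _+_; _*_; _^_; _≤_)
open import Data.Product using (_×_)
open import Relation.Binary.PropositionalEquality using (_≡_)

IsSolution : ℕ → ℕ × ℕ → Set
IsSolution n (a Data.Product., b) =
  1 ≤ a × 1 ≤ b × a * a + a * b + b * b ≡ 7 ^ (2 * n)

-- Read a² + ab + b² as the norm of an Eisenstein integer. In ℤ[ω] the prime 7
-- splits as π π̄, so multiplying by π² multiplies the norm by 49; starting from
-- (3 , 5) this gives a solution at every level 7^(2k) with 7 ∤ a. Scaling the
-- level-k solution by 7^(n-k) yields n solutions at level 7^(2n), pairwise
-- distinct because their first coordinates have different 7-adic valuations.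
module Submission where

open import Defs
open import Data.Nat using (ℕ; _≤_; _*_)
open import Data.Product using (_×_; Σ)
open import Data.List using (List; length)
open import Data.List.Relation.Unary.All using (All)
open import Data.List.Relation.Unary.Unique.Propositional using (Unique)

open import Data.Nat using (zero; suc; _+_; _∸_; _^_; _<_; _<?_; s≤s; z≤n)
open import Data.Nat.Properties
open import Data.Nat.Coprimality using (coprime?; coprime-divisor)
open import Data.Nat.Divisibility using (_∣_; _∣?_; _∣0; divides; ∣m+n∣m⇒∣n; ∣m∣n⇒∣m+n; ∣n⇒∣m*n; m∣m*n)
open import Data.Nat.Tactic.RingSolver using (solve-∀)
open import Data.Product using (_,_; proj₁; proj₂)
open import Data.List using ([]; _∷_; map)
open import Data.List.Properties using (length-map)
open import Data.List.Relation.Unary.All using ([]; _∷_; universal)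
import Data.List.Relation.Unary.All as All
import Data.List.Relation.Unary.All.Properties as All
import Data.List.Relation.Unary.AllPairs as AllPairs
import Data.List.Relation.Unary.Unique.Propositional.Properties as Unique
open import Relation.Nullary using (¬_; yes; no)
open import Relation.Nullary.Decidable using (from-yes; from-no)
open import Relation.Binary.PropositionalEquality
open ≡-Reasoning

-- Inlined so that the ring solver sees the polynomial.
norm : ℕ → ℕ → ℕ
norm a b = a * a + a * b + b * b
{-# INLINE norm #-}

7^2[1+n]≡49*7^2n : ∀ n → 7 ^ (2 * suc n) ≡ 49 * 7 ^ (2 * n)
7^2[1+n]≡49*7^2n n = begin
  7 ^ (2 * suc n)       ≡⟨ cong (7 ^_) (*-suc 2 n) ⟩
  7 * (7 * 7 ^ (2 * n)) ≡⟨ *-assoc 7 7 (7 ^ (2 * n)) ⟨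
  49 * 7 ^ (2 * n)      ∎

≡49*[7^2n]⇒≡7^2[1+n] : ∀ {m k} n → m ≡ 49 * k → k ≡ 7 ^ (2 * n) → m ≡ 7 ^ (2 * suc n)
≡49*[7^2n]⇒≡7^2[1+n] {m} {k} n m≡49k k≡7^2n = begin
  m                ≡⟨ m≡49k ⟩
  49 * k           ≡⟨ cong (49 *_) k≡7^2n ⟩
  49 * 7 ^ (2 * n) ≡⟨ 7^2[1+n]≡49*7^2n n ⟨
  7 ^ (2 * suc n)  ∎

-- Over ℤ these are N(3a − 5b, 5a + 8b) = 49 N(a, b) and N(8a + 3b, 5b − 3a) = 49 N(a, b).
-- In ℕ the difference is given as a variable, and the identity becomes polynomial
-- in it after scaling by 9 (resp. 25).
norm[3a∸5b,5a+8b] : ∀ a b x → x + 5 * b ≡ 3 * a → norm x (5 * a + 8 * b) ≡ 49 * norm a b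
norm[3a∸5b,5a+8b] a b x x+5b≡3a = *-cancelˡ-≡ _ _ 9 (begin
  9 * norm x (5 * a + 8 * b)              ≡⟨ scale-by-3 x a b ⟩
  norm (3 * x) (5 * (3 * a) + 24 * b)     ≡⟨ cong (λ t → norm (3 * x) (5 * t + 24 * b)) x+5b≡3a ⟨
  norm (3 * x) (5 * (x + 5 * b) + 24 * b) ≡⟨ factor-49 x b ⟩
  49 * norm (x + 5 * b) (3 * b)           ≡⟨ cong (λ t → 49 * norm t (3 * b)) x+5b≡3a ⟩
  49 * norm (3 * a) (3 * b)               ≡⟨ unscale-by-3 a b ⟩
  9 * (49 * norm a b)                     ∎)
  where
  scale-by-3 : ∀ x a b → 9 * norm x (5 * a + 8 * b) ≡ norm (3 * x) (5 * (3 * a) + 24 * b)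
  scale-by-3 = solve-∀
  factor-49 : ∀ x b → norm (3 * x) (5 * (x + 5 * b) + 24 * b) ≡ 49 * norm (x + 5 * b) (3 * b)
  factor-49 = solve-∀
  unscale-by-3 : ∀ a b → 49 * norm (3 * a) (3 * b) ≡ 9 * (49 * norm a b)
  unscale-by-3 = solve-∀

norm[8a+3b,5b∸3a] : ∀ a b y → y + 3 * a ≡ 5 * b → norm (8 * a + 3 * b) y ≡ 49 * norm a b
norm[8a+3b,5b∸3a] a b y y+3a≡5b = *-cancelˡ-≡ _ _ 25 (begin
  25 * norm (8 * a + 3 * b) y             ≡⟨ scale-by-5 a b y ⟩
  norm (40 * a + 3 * (5 * b)) (5 * y)     ≡⟨ cong (λ t → norm (40 * a + 3 * t) (5 * y)) y+3a≡5b ⟨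
  norm (40 * a + 3 * (y + 3 * a)) (5 * y) ≡⟨ factor-49 a y ⟩
  49 * norm (5 * a) (y + 3 * a)           ≡⟨ cong (λ t → 49 * norm (5 * a) t) y+3a≡5b ⟩
  49 * norm (5 * a) (5 * b)               ≡⟨ unscale-by-5 a b ⟩
  25 * (49 * norm a b)                    ∎)
  where
  scale-by-5 : ∀ a b y → 25 * norm (8 * a + 3 * b) y ≡ norm (40 * a + 3 * (5 * b)) (5 * y)
  scale-by-5 = solve-∀
  factor-49 : ∀ a y → norm (40 * a + 3 * (y + 3 * a)) (5 * y) ≡ 49 * norm (5 * a) (y + 3 * a)
  factor-49 = solve-∀
  unscale-by-5 : ∀ a b → 49 * norm (5 * a) (5 * b) ≡ 25 * (49 * norm a b)
  unscale-by-5 = solve-∀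

7∣18a⇒7∣a : ∀ {a} → 7 ∣ 18 * a → 7 ∣ a
7∣18a⇒7∣a = coprime-divisor (from-yes (coprime? 7 18))

7∣3a∸5b⇒7∣a : ∀ a b x → x + 5 * b ≡ 3 * a → 7 ∣ b + 3 * a → 7 ∣ x → 7 ∣ a
7∣3a∸5b⇒7∣a a b x x+5b≡3a 7∣b+3a 7∣x =
  7∣18a⇒7∣a (subst (7 ∣_) x+5[b+3a]≡18a (∣m∣n⇒∣m+n 7∣x (∣n⇒∣m*n 5 7∣b+3a)))
  where
  regroup : ∀ x a b → x + 5 * (b + 3 * a) ≡ (x + 5 * b) + 15 * a
  regroup = solve-∀
  x+5[b+3a]≡18a : x + 5 * (b + 3 * a) ≡ 18 * a
  x+5[b+3a]≡18a = begin
    x + 5 * (b + 3 * a)  ≡⟨ regroup x a b ⟩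
    (x + 5 * b) + 15 * a ≡⟨ cong (_+ 15 * a) x+5b≡3a ⟩
    3 * a + 15 * a       ≡⟨ *-distribʳ-+ a 3 15 ⟨
    18 * a               ∎

-- Among solutions with 7 ∤ a, the congruence b ≡ 4a (mod 7) singles out those
-- divisible by one fixed prime π above 7; the steps below multiply by π², so they
-- never produce a multiple of π̄, hence of 7.
Primitive : ℕ × ℕ → Set
Primitive (a , b) = ¬ 7 ∣ a × 7 ∣ b + 3 * a

PrimitiveSolution : ℕ → ℕ × ℕ → Set
PrimitiveSolution n p = IsSolution n p × Primitive p

Primitive⇒3a≢5b : ∀ {a b} → Primitive (a , b) → 3 * a ≢ 5 * b
Primitive⇒3a≢5b {a} {b} (7∤a , 7∣b+3a) 3a≡5b =
  7∤a (7∣3a∸5b⇒7∣a a b 0 (sym 3a≡5b) 7∣b+3a (7 ∣0))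

Primitive[3a∸5b,5a+8b] : ∀ a b x → x + 5 * b ≡ 3 * a → Primitive (a , b) →
                         Primitive (x , 5 * a + 8 * b)
Primitive[3a∸5b,5a+8b] a b x x+5b≡3a (7∤a , 7∣b+3a) =
  (λ 7∣x → 7∤a (7∣3a∸5b⇒7∣a a b x x+5b≡3a 7∣b+3a 7∣x)) ,
  ∣m+n∣m⇒∣n (subst (7 ∣_) 7[2a]≡7b+[y+3x] (m∣m*n (2 * a))) (m∣m*n b)
  where
  y : ℕ
  y = 5 * a + 8 * b
  regroup : ∀ x a b → 7 * b + (5 * a + 8 * b + 3 * x) ≡ 5 * a + 3 * (x + 5 * b)
  regroup = solve-∀
  14a : ∀ a → 5 * a + 3 * (3 * a) ≡ 7 * (2 * a)
  14a = solve-∀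
  7[2a]≡7b+[y+3x] : 7 * (2 * a) ≡ 7 * b + (y + 3 * x)
  7[2a]≡7b+[y+3x] = sym (begin
    7 * b + (y + 3 * x)     ≡⟨ regroup x a b ⟩
    5 * a + 3 * (x + 5 * b) ≡⟨ cong (λ t → 5 * a + 3 * t) x+5b≡3a ⟩
    5 * a + 3 * (3 * a)     ≡⟨ 14a a ⟩
    7 * (2 * a)             ∎)

Primitive[8a+3b,5b∸3a] : ∀ a b y → y + 3 * a ≡ 5 * b → Primitive (a , b) →
                         Primitive (8 * a + 3 * b , y)
Primitive[8a+3b,5b∸3a] a b y y+3a≡5b (7∤a , 7∣b+3a) =
  (λ 7∣x → 7∤a (∣m+n∣m⇒∣n (subst (7 ∣_) (3[b+3a]≡x+a a b) (∣n⇒∣m*n 3 7∣b+3a)) 7∣x)) ,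
  subst (7 ∣_) 7[3a+2b]≡y+3x (m∣m*n (3 * a + 2 * b))
  where
  x : ℕ
  x = 8 * a + 3 * b
  3[b+3a]≡x+a : ∀ a b → 3 * (b + 3 * a) ≡ 8 * a + 3 * b + a
  3[b+3a]≡x+a = solve-∀
  regroup : ∀ y a b → y + 3 * (8 * a + 3 * b) ≡ (y + 3 * a) + 21 * a + 9 * b
  regroup = solve-∀
  21a+14b : ∀ a b → 5 * b + 21 * a + 9 * b ≡ 7 * (3 * a + 2 * b)
  21a+14b = solve-∀
  7[3a+2b]≡y+3x : 7 * (3 * a + 2 * b) ≡ y + 3 * x
  7[3a+2b]≡y+3x = sym (begin
    y + 3 * x                    ≡⟨ regroup y a b ⟩
    (y + 3 * a) + 21 * a + 9 * b ≡⟨ cong (λ t → t + 21 * a + 9 * b) y+3a≡5b ⟩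
    5 * b + 21 * a + 9 * b       ≡⟨ 21a+14b a b ⟩
    7 * (3 * a + 2 * b)          ∎)

primitiveSolution[3a∸5b,5a+8b] : ∀ n {a b} → 5 * b < 3 * a → PrimitiveSolution n (a , b) →
                                 PrimitiveSolution (suc n) (3 * a ∸ 5 * b , 5 * a + 8 * b)
primitiveSolution[3a∸5b,5a+8b] n {a} {b} 5b<3a ((1≤a , _ , a,b≡7^2n) , prim) =
  (m<n⇒0<n∸m 5b<3a , ≤-trans (m≤n⇒m≤o*n 5 1≤a) (m≤m+n _ _) ,
   ≡49*[7^2n]⇒≡7^2[1+n] n (norm[3a∸5b,5a+8b] a b (3 * a ∸ 5 * b) x+5b≡3a) a,b≡7^2n) ,
  Primitive[3a∸5b,5a+8b] a b (3 * a ∸ 5 * b) x+5b≡3a prim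
  where
  x+5b≡3a : 3 * a ∸ 5 * b + 5 * b ≡ 3 * a
  x+5b≡3a = m∸n+n≡m (<⇒≤ 5b<3a)

primitiveSolution[8a+3b,5b∸3a] : ∀ n {a b} → 3 * a < 5 * b → PrimitiveSolution n (a , b) →
                                 PrimitiveSolution (suc n) (8 * a + 3 * b , 5 * b ∸ 3 * a)
primitiveSolution[8a+3b,5b∸3a] n {a} {b} 3a<5b ((1≤a , _ , a,b≡7^2n) , prim) =
  (≤-trans (m≤n⇒m≤o*n 8 1≤a) (m≤m+n _ _) , m<n⇒0<n∸m 3a<5b ,
   ≡49*[7^2n]⇒≡7^2[1+n] n (norm[8a+3b,5b∸3a] a b (5 * b ∸ 3 * a) y+3a≡5b) a,b≡7^2n) ,
  Primitive[8a+3b,5b∸3a] a b (5 * b ∸ 3 * a) y+3a≡5b prim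
  where
  y+3a≡5b : 5 * b ∸ 3 * a + 3 * a ≡ 5 * b
  y+3a≡5b = m∸n+n≡m (<⇒≤ 3a<5b)

primitiveSolution-step : ∀ n {p} → PrimitiveSolution n p → Σ (ℕ × ℕ) (PrimitiveSolution (suc n))
primitiveSolution-step n {a , b} s with 5 * b <? 3 * a
... | yes 5b<3a = _ , primitiveSolution[3a∸5b,5a+8b] n 5b<3a s
... | no 5b≮3a  = _ , primitiveSolution[8a+3b,5b∸3a] n 3a<5b s
  where
  3a<5b : 3 * a < 5 * b
  3a<5b = ≤∧≢⇒< (≮⇒≥ 5b≮3a) (Primitive⇒3a≢5b {a} {b} (proj₂ s))

primitiveSolution : ∀ n → Σ (ℕ × ℕ) (PrimitiveSolution (suc n))
primitiveSolution zero    = (3 , 5) , (s≤s z≤n , s≤s z≤n , refl) , from-no (7 ∣? 3) , divides 2 refl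
primitiveSolution (suc n) = primitiveSolution-step (suc n) (proj₂ (primitiveSolution n))

scale7 : ℕ × ℕ → ℕ × ℕ
scale7 (a , b) = 7 * a , 7 * b

scale7-injective : ∀ {p q} → scale7 p ≡ scale7 q → p ≡ q
scale7-injective {a , b} {c , d} eq =
  cong₂ _,_ (*-cancelˡ-≡ a c 7 (cong proj₁ eq)) (*-cancelˡ-≡ b d 7 (cong proj₂ eq))

scale7-isSolution : ∀ n {p} → IsSolution n p → IsSolution (suc n) (scale7 p)
scale7-isSolution n {a , b} (1≤a , 1≤b , a,b≡7^2n) =
  m≤n⇒m≤o*n 7 1≤a , m≤n⇒m≤o*n 7 1≤b , ≡49*[7^2n]⇒≡7^2[1+n] n (norm-scale-7 a b) a,b≡7^2n
  where
  norm-scale-7 : ∀ a b → norm (7 * a) (7 * b) ≡ 49 * norm a b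
  norm-scale-7 = solve-∀

¬7∣a⇒≢scale7 : ∀ {p} → ¬ 7 ∣ proj₁ p → ∀ q → p ≢ scale7 q
¬7∣a⇒≢scale7 7∤a (a , _) refl = 7∤a (m∣m*n a)

solutions : ℕ → List (ℕ × ℕ)
solutions zero    = []
solutions (suc n) = proj₁ (primitiveSolution n) ∷ map scale7 (solutions n)

length-solutions : ∀ n → length (solutions n) ≡ n
length-solutions zero    = refl
length-solutions (suc n) = cong suc (trans (length-map scale7 (solutions n)) (length-solutions n))

solutions-isSolution : ∀ n → All (IsSolution n) (solutions n)
solutions-isSolution zero    = []
solutions-isSolution (suc n) =
  proj₁ (proj₂ (primitiveSolution n)) ∷ All.map⁺ (All.map (scale7-isSolution n) (solutions-isSolution n))

solutions-unique : ∀ n → Unique (solutions n)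
solutions-unique zero    = AllPairs.[]
solutions-unique (suc n) =
  let (_ , _ , 7∤a , _) = primitiveSolution n in
  All.map⁺ (universal (¬7∣a⇒≢scale7 7∤a) (solutions n))
    AllPairs.∷ Unique.map⁺ scale7-injective (solutions-unique n)

corollary1 : (n : ℕ) → 1 ≤ n → Σ (List (ℕ × ℕ)) λ sols → (n ≤ length sols × Unique sols × All (IsSolution n) sols)
corollary1 n _ = solutions n , ≤-reflexive (sym (length-solutions n)) , solutions-unique n , solutions-isSolution n
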